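{- If $T$ is an $(\iota,1)$-critical tree, then $T$ has exactly one isolating set of size $\iota(T)$.
   Context: For $D\subseteq V(T)$, $N[D]$ is $D$ with all neighbours; $D$ is isolating if $T-N[D]$ has no edges; $\iota(T)$ is the minimum size of an isolating set. $T_e$ is obtained by subdividing edge $e$ once. $T$ is $(\iota,1)$-critical if $\iota(T_e)>\iota(T)$ for every edge $e$ of $T$ (and $T$ has an edge). -}

module Defs where

open import Data.Nat using (ℕ; zero; suc; _<_)
open import Data.Fin using (Fin; zero; suc; _≟_)
open import Data.Fin.Subset using (Subset; _∈_; ∣_∣)
open import Data.Bool using (Bool; true; false; T; _∧_; _∨_; not)
open import Data.List using (List; []; _∷_; _∷ʳ_)
open import Data.List.Relation.Unary.Linked using (Linked)
open import Data.List.Relation.Unary.Unique.Propositional using (Unique)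
open import Data.Product using (Σ; ∃; ∃-syntax; _×_; _,_)
open import Data.Sum using (_⊎_)
open import Relation.Nullary using (¬_)
open import Relation.Nullary.Decidable using (⌊_⌋)
open import Relation.Binary.PropositionalEquality using (_≡_)

Graph : ℕ → Set
Graph n = Fin n → Fin n → Bool

module _ {n : ℕ} (G : Graph n) where

  Adj : Fin n → Fin n → Set
  Adj u v = T (G u v)

  Symmetric : Set
  Symmetric = ∀ u v → Adj u v → Adj v u

  Irreflexive : Set
  Irreflexive = ∀ u → ¬ Adj u u

  data Walk : Fin n → Fin n → Set where
    [] : ∀ {u} → Walk u u
    _∷_ : ∀ {u v w} → Adj u v → Walk v w → Walk u w

  Connected : Set
  Connected = ∀ u v → Walk u v

  HasCycle : Set
  HasCycle = ∃[ x ] ∃[ y ] ∃[ z ] ∃[ ws ]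
    (Unique (x ∷ y ∷ z ∷ ws) × Linked Adj ((x ∷ y ∷ z ∷ ws) ∷ʳ x))

  IsTree : Set
  IsTree = Symmetric × Irreflexive × Connected × ¬ HasCycle

  HasEdge : Set
  HasEdge = ∃[ u ] ∃[ v ] Adj u v

  InClosedNbhd : Subset n → Fin n → Set
  InClosedNbhd D v = v ∈ D ⊎ (∃[ u ] (u ∈ D × Adj u v))

  -- T - N[D] has no edges: every edge has an endpoint in N[D]
  Isolating : Subset n → Set
  Isolating D = ∀ u v → Adj u v → InClosedNbhd D u ⊎ InClosedNbhd D v

  IsolationNumber : ℕ → Set
  IsolationNumber k =
    (∃[ D ] (Isolating D × ∣ D ∣ ≡ k)) × (∀ D → Isolating D → k ≤' ∣ D ∣)
    where
    open import Data.Nat using () renaming (_≤_ to _≤'_)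

-- T_e for e = uv: new vertex zero, old vertex a becomes suc a;
-- edge uv is replaced by the edges u-zero and zero-v.
subdivide : ∀ {n} → Graph n → Fin n → Fin n → Graph (suc n)
subdivide G u v zero    zero    = false
subdivide G u v zero    (suc b) = ⌊ b ≟ u ⌋ ∨ ⌊ b ≟ v ⌋
subdivide G u v (suc a) zero    = ⌊ a ≟ u ⌋ ∨ ⌊ a ≟ v ⌋
subdivide G u v (suc a) (suc b) =
  G a b ∧ not ((⌊ a ≟ u ⌋ ∧ ⌊ b ≟ v ⌋) ∨ (⌊ a ≟ v ⌋ ∧ ⌊ b ≟ u ⌋))

IotaOneCritical : ∀ {n} → Graph n → Set
IotaOneCritical G = HasEdge G ×
  (∀ u v → Adj G u v → ∀ k k' → IsolationNumber G k →
     IsolationNumber (subdivide G u v) k' → k < k')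

-- Let D be a minimum isolating set of the (ι,1)-critical tree T. Criticality forbids any
-- subdivision T_uv from having an isolating set of size ι(T) that avoids the new vertex;
-- building such sets from D shows that D is independent, that its boundary
-- ∂D = N[D] ∖ D is independent, that every vertex of ∂D has exactly one neighbour in D
-- and a neighbour outside N[D], and that no vertex of D is a leaf. Hence every edge
-- joins ∂D to its complement: membership in ∂D is a proper 2-colouring of T.
-- For a second minimum isolating set D', the colourings ∂D and ∂D' of the connected
-- tree T are equal or complementary. If complementary, every vertex lies in ∂D or ∂D'
-- and so has degree at least 2, impossible in a finite tree. If equal, the vertices of
-- D △ D' together with their boundary neighbours induce a subgraph of minimum degree
-- at least 2 (a boundary vertex next to D ∖ D' also sees its D'-neighbour, which lies
-- in D' ∖ D), so again T would contain a cycle unless D △ D' is empty.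
module Submission where

open import Defs
open import Data.Bool using (Bool; true; false; T; not; _∧_; _∨_)
import Data.Bool.Properties as Bool
open import Data.Bool.Properties using (T-∧; T-∨; ¬-not)
open import Data.Empty using (⊥; ⊥-elim)
open import Data.Unit using (tt)
open import Data.Fin using (Fin; zero; suc; _≟_)
open import Data.Fin.Properties using (any?; all?; injective⇒≤; ¬∀⟶∃¬)
open import Data.Fin.Subset using (Subset; _∈_; _∉_; _⊆_; ∣_∣; inside; outside; ⊤; _∪_; _-_; ⁅_⁆)
open import Data.Fin.Subset.Properties
  using (_∈?_; anySubset?; ∈⊤; ⊆-antisym; x∈p∪q⁺; x∈⁅x⁆; x∈p∧x≢y⇒x∈p-y; ∣⁅x⁆∣≡1; x∈p⇒∣p-x∣<∣p∣)
open import Data.Vec using ([]; _∷_; here; there)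
open import Data.List using (List; []; _∷_; _∷ʳ_; length; lookup)
open import Data.List.Membership.Propositional using () renaming (_∈_ to _∈ˡ_)
open import Data.List.Relation.Binary.Subset.Propositional using () renaming (_⊆_ to _⊆ˡ_)
open import Data.List.Relation.Binary.Subset.Propositional.Properties using (∷⁺ʳ)
open import Data.List.Membership.Propositional.Properties using (∈-lookup)
open import Data.List.Relation.Unary.All as All using (All; []; _∷_)
open import Data.List.Relation.Unary.All.Properties using (anti-mono; ¬Any⇒All¬)
open import Data.List.Relation.Unary.AllPairs using ([]; _∷_)
open import Data.List.Relation.Unary.Any using (here; there)
open import Data.List.Relation.Unary.Linked using (Linked; []; [-]; _∷_)
open import Data.List.Relation.Unary.Unique.Propositional using (Unique)
open import Data.Nat using (ℕ; zero; suc; _+_; _≤_; _<_; s≤s; z≤n) renaming (_≟_ to _≟ℕ_)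
open import Data.Nat.Induction using (<-rec)
open import Data.Nat.Properties
  using (anyUpTo?; ≮⇒≥; 1+n≰n; n≤1+n; ≤-trans; ≤-reflexive; <-≤-trans; <⇒≱; +-suc; +-monoʳ-≤; +-comm;
         module ≤-Reasoning)
open import Data.Product as Product using (∃; ∃-syntax; _×_; _,_; proj₁; proj₂)
open import Data.Sum as Sum using (_⊎_; inj₁; inj₂; swap)
open import Function using (case_of_; id; _∘_)
open import Function.Bundles using (Equivalence)
open import Function.Definitions using (Injective)
open import Relation.Nullary using (¬_; Dec; yes; no; does)
open import Relation.Nullary.Decidable
  using (T?; _×-dec_; _⊎-dec_; _→-dec_; ¬?; toWitness; fromWitness; ⌊_⌋)
open import Relation.Unary using (Decidable)
open import Relation.Binary.PropositionalEquality
  using (_≡_; _≢_; refl; sym; cong; subst; module ≡-Reasoning)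

least-witness : {P : ℕ → Set} → Decidable P → ∀ m → P m → ∃[ k ] (P k × ∀ j → P j → k ≤ j)
least-witness P? = <-rec _ λ m smaller Pm → case anyUpTo? P? m of λ where
  (yes (j , j<m , Pj)) → smaller j<m Pj
  (no none)            → m , Pm , λ j Pj → ≮⇒≥ λ j<m → none (j , j<m , Pj)

does-complement : ∀ {A B : Set} (a? : Dec A) (b? : Dec B) →
                  (A → ¬ B) → (¬ A → B) → does b? ≡ not (does a?)
does-complement (yes a) (yes b) A⇒¬B _    = ⊥-elim (A⇒¬B a b)
does-complement (yes _) (no _)  _    _    = refl
does-complement (no _)  (yes _) _    _    = refl
does-complement (no ¬a) (no ¬b) _    ¬A⇒B = ⊥-elim (¬b (¬A⇒B ¬a))

does-transport : ∀ {A B : Set} (a? : Dec A) (b? : Dec B) → does b? ≡ does a? → A → B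
does-transport _       (yes b) _  _ = b
does-transport (no ¬a) (no _)  _  a = ⊥-elim (¬a a)
does-transport (yes _) (no _)  () _

does-complement⁻ : ∀ {A B : Set} (a? : Dec A) (b? : Dec B) → does b? ≡ not (does a?) → A ⊎ B
does-complement⁻ (yes a) _       _  = inj₁ a
does-complement⁻ (no _)  (yes b) _  = inj₂ b
does-complement⁻ (no _)  (no _)  ()

counterexample : ∀ {n} {P Q : Fin n → Set} → Decidable P → Decidable Q →
                 ¬ (∀ y → P y → Q y) → ∃[ y ] (P y × ¬ Q y)
counterexample {n} P? Q? ¬all with ¬∀⟶∃¬ n _ (λ y → P? y →-dec Q? y) ¬all
... | y , ¬P⇒Q with P? y
...   | yes Py = y , Py , λ Qy → ¬P⇒Q λ _ → Qy
...   | no ¬Py = ⊥-elim (¬P⇒Q λ Py → ⊥-elim (¬Py Py))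

∣p∪q∣≤∣p∣+∣q∣ : ∀ {n} (p q : Subset n) → ∣ p ∪ q ∣ ≤ ∣ p ∣ + ∣ q ∣
∣p∪q∣≤∣p∣+∣q∣ []            []            = z≤n
∣p∪q∣≤∣p∣+∣q∣ (outside ∷ p) (outside ∷ q) = ∣p∪q∣≤∣p∣+∣q∣ p q
∣p∪q∣≤∣p∣+∣q∣ (outside ∷ p) (inside  ∷ q) =
  ≤-trans (s≤s (∣p∪q∣≤∣p∣+∣q∣ p q)) (≤-reflexive (sym (+-suc ∣ p ∣ ∣ q ∣)))
∣p∪q∣≤∣p∣+∣q∣ (inside  ∷ p) (outside ∷ q) = s≤s (∣p∪q∣≤∣p∣+∣q∣ p q)
∣p∪q∣≤∣p∣+∣q∣ (inside  ∷ p) (inside  ∷ q) =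
  s≤s (≤-trans (∣p∪q∣≤∣p∣+∣q∣ p q) (+-monoʳ-≤ ∣ p ∣ (n≤1+n ∣ q ∣)))

unique⇒lookup-injective : ∀ {a} {A : Set a} {xs : List A} → Unique xs → Injective _≡_ _≡_ (lookup xs)
unique⇒lookup-injective {xs = _ ∷ _} (_  ∷ _) {zero}  {zero}  _  = refl
unique⇒lookup-injective {xs = _ ∷ _} (x∉ ∷ _) {zero}  {suc j} eq = ⊥-elim (All.lookup x∉ (∈-lookup j) eq)
unique⇒lookup-injective {xs = _ ∷ _} (x∉ ∷ _) {suc i} {zero}  eq = ⊥-elim (All.lookup x∉ (∈-lookup i) (sym eq))
unique⇒lookup-injective {xs = _ ∷ _} (_  ∷ u) {suc i} {suc j} eq = cong suc (unique⇒lookup-injective u eq)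

unique⇒length≤ : ∀ {n} {xs : List (Fin n)} → Unique xs → length xs ≤ n
unique⇒length≤ u = injective⇒≤ (unique⇒lookup-injective u)

module _ {n : ℕ} (G : Graph n) where

  adj? : ∀ u v → Dec (Adj G u v)
  adj? u v = T? (G u v)

  inClosedNbhd? : ∀ S v → Dec (InClosedNbhd G S v)
  inClosedNbhd? S v = v ∈? S ⊎-dec any? λ u → u ∈? S ×-dec adj? u v

  isolating? : ∀ S → Dec (Isolating G S)
  isolating? S = all? λ u → all? λ v →
    adj? u v →-dec (inClosedNbhd? S u ⊎-dec inClosedNbhd? S v)

  isolationNumber-exists : ∃ (IsolationNumber G)
  isolationNumber-exists =
    let k , smallest , least = least-witness isolating-of-size? ∣ ⊤ {n} ∣ (⊤ , ⊤-isolating , refl)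
    in k , smallest , λ D iso → least ∣ D ∣ (D , iso , refl)
    where
    isolating-of-size? : Decidable λ k → ∃[ D ] (Isolating G D × ∣ D ∣ ≡ k)
    isolating-of-size? k = anySubset? λ D → isolating? D ×-dec ∣ D ∣ ≟ℕ k
    ⊤-isolating : Isolating G ⊤
    ⊤-isolating _ _ _ = inj₁ (inj₁ ∈⊤)

  Boundary : Subset n → Fin n → Set
  Boundary S v = v ∉ S × InClosedNbhd G S v

  boundary? : ∀ S v → Dec (Boundary S v)
  boundary? S v = ¬? (v ∈? S) ×-dec inClosedNbhd? S v

  walk-preserves : {P : Fin n → Set} → (∀ {a b} → Adj G a b → P a → P b) →
                   ∀ {u v} → Walk G u v → P u → P v
  walk-preserves step []         Pu = Pu
  walk-preserves step (ab ∷ bv) Pu = walk-preserves step bv (step ab Pu)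

  TwoNeighboursIn : (Fin n → Set) → Fin n → Set
  TwoNeighboursIn W c = ∀ p → ∃[ q ] (Adj G c q × q ≢ p × W q)

  MinDegree≥2 : (Fin n → Set) → Set
  MinDegree≥2 W = ∀ {c} → W c → TwoNeighboursIn W c

  two-neighbours : ∀ {W c a b} → Adj G c a → Adj G c b → a ≢ b → W a → W b → TwoNeighboursIn W c
  two-neighbours {b = b} ca cb a≢b Wa Wb p with b ≟ p
  ... | yes refl = _ , ca , a≢b , Wa
  ... | no b≢p   = b , cb , b≢p , Wb

  connected⇒neighbour : Connected G → HasEdge G → ∀ v → ∃[ w ] Adj G v w
  connected⇒neighbour connected (a , b , ab) v with connected v a
  ... | []     = b , ab
  ... | vw ∷ _ = _ , vw

  ProperColouring : (Fin n → Bool) → Set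
  ProperColouring c = ∀ {a b} → Adj G a b → c b ≡ not (c a)

  proper-colourings-equal-or-opposite :
    Connected G → ∀ {c c′} → ProperColouring c → ProperColouring c′ →
    ∀ r → (∀ v → c′ v ≡ c v) ⊎ (∀ v → c′ v ≡ not (c v))
  proper-colourings-equal-or-opposite connected {c} {c′} proper proper′ r =
    case c′ r Bool.≟ c r of λ where
      (yes equal)  → inj₁ λ v → walk-preserves (step id λ _ → refl) (connected r v) equal
      (no unequal) → inj₂ λ v → walk-preserves (step not λ _ → refl) (connected r v) (¬-not unequal)
    where
    step : (f : Bool → Bool) → (∀ x → f (not x) ≡ not (f x)) →
           ∀ {a b} → Adj G a b → c′ a ≡ f (c a) → c′ b ≡ f (c b)
    step f f-not {a} {b} ab eq = begin
      c′ b           ≡⟨ proper′ ab ⟩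
      not (c′ a)     ≡⟨ cong not eq ⟩
      not (f (c a))  ≡⟨ f-not (c a) ⟨
      f (not (c a))  ≡⟨ cong f (proper ab) ⟨
      f (c b)        ∎
      where open ≡-Reasoning

module _ {n : ℕ} {G : Graph n} where

  truncate-path : ∀ {r vs q c} → Unique (r ∷ vs) → Linked (Adj G) (r ∷ vs) → q ∈ˡ r ∷ vs → Adj G q c →
                  ∃[ ps ] (ps ⊆ˡ vs × Unique (r ∷ ps) × Linked (Adj G) ((r ∷ ps) ∷ʳ c))
  truncate-path _ _ (here refl) qc = [] , (λ ()) , ([] ∷ []) , (qc ∷ [-])
  truncate-path {vs = r′ ∷ _} (r∉ ∷ u) (rr′ ∷ l) (there q∈) qc with truncate-path u l q∈ qc
  ... | ps , ps⊆ , ups , lps = r′ ∷ ps , ∷⁺ʳ r′ ps⊆ , anti-mono (∷⁺ʳ r′ ps⊆) r∉ ∷ ups , rr′ ∷ lps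

  revisit⇒cycle : ∀ {c p vs q} → Unique (c ∷ p ∷ vs) → Linked (Adj G) (c ∷ p ∷ vs) →
                  q ∈ˡ vs → Adj G q c → HasCycle G
  revisit⇒cycle {vs = _ ∷ _} (c∉ ∷ p∉ ∷ u) (cp ∷ pr ∷ l) q∈ qc with truncate-path u l q∈ qc
  ... | ps , ps⊆ , ups , lps =
    _ , _ , _ , ps ,
    (anti-mono (∷⁺ʳ _ (∷⁺ʳ _ ps⊆)) c∉ ∷ anti-mono (∷⁺ʳ _ ps⊆) p∉ ∷ ups) , cp ∷ pr ∷ lps

-- A trail inside W can always be extended without revisiting a vertex, yet has at most n vertices.
module _ {n : ℕ} {G : Graph n} (adj-sym : Symmetric G) (adj-irrefl : Irreflexive G)
         (acyclic : ¬ HasCycle G) {W : Fin n → Set} (minDegree≥2 : MinDegree≥2 G W) where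

  open import Data.List.Membership.DecPropositional {A = Fin n} _≟_
    using () renaming (_∈?_ to _∈ˡ?_)

  private
    record Trail (m : ℕ) : Set where
      constructor trail
      field
        {prev cur}     : Fin n
        {visited}      : List (Fin n)
        length-visited : length visited ≡ m
        unique         : Unique (cur ∷ prev ∷ visited)
        linked         : Linked (Adj G) (cur ∷ prev ∷ visited)
        cur∈W          : W cur

    grow : ∀ {m} → Trail m → Trail (suc m)
    grow (trail {p} {c} {vs} refl u l w) with minDegree≥2 w p
    ... | q , cq , q≢p , wq with q ∈ˡ? vs
    ...   | yes q∈vs = ⊥-elim (acyclic (revisit⇒cycle u l q∈vs (adj-sym c q cq)))
    ...   | no q∉vs  = trail refl (fresh ∷ u) (adj-sym c q cq ∷ l) wq
      where
      fresh : All (q ≢_) (c ∷ p ∷ vs)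
      fresh = (λ { refl → adj-irrefl q cq }) ∷ q≢p ∷ ¬Any⇒All¬ vs q∉vs

    iterate : Trail 0 → ∀ m → Trail m
    iterate t zero    = t
    iterate t (suc m) = grow (iterate t m)

    trail-bounded : ∀ {m} → Trail m → 2 + m ≤ n
    trail-bounded (trail refl u _ _) = unique⇒length≤ u

  acyclic⇒¬minDegree≥2 : ∀ {c} → ¬ W c
  acyclic⇒¬minDegree≥2 {c} wc with minDegree≥2 wc c
  ... | q , cq , q≢c , wq = 1+n≰n (≤-trans (n≤1+n _) (trail-bounded (iterate start n)))
    where
    start : Trail 0
    start = trail refl ((q≢c ∷ []) ∷ [] ∷ []) (adj-sym c q cq ∷ [-]) wq

module Subdivision {n : ℕ} (G : Graph n) (u v : Fin n) where

  Gᵤᵥ : Graph (suc n)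
  Gᵤᵥ = subdivide G u v

  IsUV : Fin n → Fin n → Set
  IsUV a b = (a ≡ u × b ≡ v) ⊎ (a ≡ v × b ≡ u)

  isUVᵇ : Fin n → Fin n → Bool
  isUVᵇ a b = ⌊ a ≟ u ⌋ ∧ ⌊ b ≟ v ⌋ ∨ ⌊ a ≟ v ⌋ ∧ ⌊ b ≟ u ⌋

  isUVᵇ⇒IsUV : ∀ {a b} → T (isUVᵇ a b) → IsUV a b
  isUVᵇ⇒IsUV {a} {b} c = Sum.map both both (Equivalence.to (T-∨ {⌊ a ≟ u ⌋ ∧ ⌊ b ≟ v ⌋}) c)
    where
    both : ∀ {x y x′ y′} → T (⌊ x ≟ x′ ⌋ ∧ ⌊ y ≟ y′ ⌋) → x ≡ x′ × y ≡ y′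
    both {x} {y} {x′} {y′} t =
      Product.map toWitness toWitness (Equivalence.to (T-∧ {⌊ x ≟ x′ ⌋} {⌊ y ≟ y′ ⌋}) t)

  adj-kept : ∀ {a b} → Adj G a b → ¬ T (isUVᵇ a b) → Adj Gᵤᵥ (suc a) (suc b)
  adj-kept {a} {b} ab ¬isUV with isUVᵇ a b
  ... | true  = ⊥-elim (¬isUV tt)
  ... | false = Equivalence.from T-∧ (ab , tt)

  adj-kept⁻ : ∀ {a b} → Adj Gᵤᵥ (suc a) (suc b) → Adj G a b
  adj-kept⁻ e = proj₁ (Equivalence.to T-∧ e)

  adj-new⁻ : ∀ {b} → Adj Gᵤᵥ zero (suc b) → b ≡ u ⊎ b ≡ v
  adj-new⁻ {b} e = Sum.map toWitness toWitness (Equivalence.to (T-∨ {⌊ b ≟ u ⌋}) e)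

  -- A subset S of V(G) is read as the subset outside ∷ S of V(Gᵤᵥ), avoiding the new vertex zero.
  module _ (S : Subset n) where

    Nᵤᵥ : Fin (suc n) → Set
    Nᵤᵥ = InClosedNbhd Gᵤᵥ (outside ∷ S)

    nbhd-lift : ∀ {a} → InClosedNbhd G S a → Nᵤᵥ (suc a) ⊎ ∃[ c ] (c ∈ S × IsUV c a)
    nbhd-lift (inj₁ a∈S) = inj₁ (inj₁ (there a∈S))
    nbhd-lift {a} (inj₂ (c , c∈S , ca)) with T? (isUVᵇ c a)
    ... | yes isUV = inj₂ (c , c∈S , isUVᵇ⇒IsUV isUV)
    ... | no ¬isUV = inj₁ (inj₂ (suc c , there c∈S , adj-kept ca ¬isUV))

    new-vertex-dominated : u ∈ S → Nᵤᵥ zero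
    new-vertex-dominated u∈S =
      inj₂ (suc u , there u∈S , Equivalence.from T-∨ (inj₁ (fromWitness {a? = u ≟ u} refl)))

    isolating-subdivision : Nᵤᵥ zero ⊎ (Nᵤᵥ (suc u) × Nᵤᵥ (suc v)) →
                            (∀ a b → Adj G a b → Nᵤᵥ (suc a) ⊎ Nᵤᵥ (suc b)) →
                            Isolating Gᵤᵥ (outside ∷ S)
    isolating-subdivision new old zero    (suc b) e = new-edge new (adj-new⁻ e)
      where
      new-edge : Nᵤᵥ zero ⊎ (Nᵤᵥ (suc u) × Nᵤᵥ (suc v)) → b ≡ u ⊎ b ≡ v →
                 Nᵤᵥ zero ⊎ Nᵤᵥ (suc b)
      new-edge (inj₁ N0)       _            = inj₁ N0
      new-edge (inj₂ (Nu , _)) (inj₁ refl) = inj₂ Nu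
      new-edge (inj₂ (_ , Nv)) (inj₂ refl) = inj₂ Nv
    isolating-subdivision new old (suc a) zero    e = swap (isolating-subdivision new old zero (suc a) e)
    isolating-subdivision new old (suc a) (suc b) e = old a b (adj-kept⁻ e)

    dominated-by : ∀ {c a} → c ∈ S → Adj G c a → ¬ IsUV c a → Nᵤᵥ (suc a)
    dominated-by c∈S ca ¬uv = inj₂ (suc _ , there c∈S , adj-kept ca (¬uv ∘ isUVᵇ⇒IsUV))

    nbhd-preserved : (∀ {c a} → c ∈ S → IsUV c a → Nᵤᵥ (suc a)) →
                     ∀ {a} → InClosedNbhd G S a → Nᵤᵥ (suc a)
    nbhd-preserved repair Na = Sum.[ id , (λ (_ , c∈S , uv) → repair c∈S uv) ]′ (nbhd-lift Na)

    isolating-subdivision-preserved : Isolating G S →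
                                      (∀ {c a} → c ∈ S → IsUV c a → Nᵤᵥ (suc a)) →
                                      Nᵤᵥ zero ⊎ (Nᵤᵥ (suc u) × Nᵤᵥ (suc v)) →
                                      Isolating Gᵤᵥ (outside ∷ S)
    isolating-subdivision-preserved iso repair new = isolating-subdivision new λ a b ab →
      Sum.map (nbhd-preserved repair) (nbhd-preserved repair) (iso a b ab)

critical⇒isolating-subdivision-exceeds :
  ∀ {n} {G : Graph n} → IotaOneCritical G → ∀ {k} → IsolationNumber G k →
  ∀ {u v} → Adj G u v → ∀ {S} → Isolating (subdivide G u v) (outside ∷ S) → k < ∣ S ∣
critical⇒isolating-subdivision-exceeds (_ , critical) ι {u} {v} uv {S} iso =
  let k′ , ι′ = isolationNumber-exists (subdivide _ u v)
  in <-≤-trans (critical u v uv _ k′ ι ι′) (proj₂ ι′ (outside ∷ S) iso)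

module MinimumIsolating {n : ℕ} {G : Graph n} (adj-sym : Symmetric G) (adj-irrefl : Irreflexive G)
                        (critical : IotaOneCritical G) {k : ℕ} (ι : IsolationNumber G k)
                        {D : Subset n} (iso : Isolating G D) (size : ∣ D ∣ ≡ k) where

  private
    ND : Fin n → Set
    ND = InClosedNbhd G D

    no-isolating-subdivision : ∀ {u v S} → Adj G u v → ∣ S ∣ ≤ k →
                               ¬ Isolating (subdivide G u v) (outside ∷ S)
    no-isolating-subdivision uv S≤k iso′ =
      <⇒≱ (critical⇒isolating-subdivision-exceeds critical ι uv iso′) S≤k

    D≤k : ∣ D ∣ ≤ k
    D≤k = ≤-reflexive size

  independent : ∀ {a b} → a ∈ D → b ∈ D → ¬ Adj G a b
  independent {a} {b} a∈D b∈D ab = no-isolating-subdivision ab D≤k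
    (isolating-subdivision-preserved D iso repair (inj₁ (new-vertex-dominated D a∈D)))
    where
    open Subdivision G a b
    repair : ∀ {c x} → c ∈ D → IsUV c x → Nᵤᵥ D (suc x)
    repair _ (inj₁ (_ , refl)) = inj₁ (there b∈D)
    repair _ (inj₂ (_ , refl)) = inj₁ (there a∈D)

  boundary-independent : ∀ {a b} → Boundary G D a → Boundary G D b → ¬ Adj G a b
  boundary-independent {a} {b} (a∉D , Na) (b∉D , Nb) ab = no-isolating-subdivision ab D≤k
    (isolating-subdivision-preserved D iso repair
      (inj₂ (nbhd-preserved D repair Na , nbhd-preserved D repair Nb)))
    where
    open Subdivision G a b
    repair : ∀ {c x} → c ∈ D → IsUV c x → Nᵤᵥ D (suc x)
    repair c∈D (inj₁ (refl , _)) = ⊥-elim (a∉D c∈D)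
    repair c∈D (inj₂ (refl , _)) = ⊥-elim (b∉D c∈D)

  unique-neighbour : ∀ {x d d′} → x ∉ D → d ∈ D → d′ ∈ D → Adj G d x → Adj G d′ x → d′ ≡ d
  unique-neighbour {x} {d} {d′} x∉D d∈D d′∈D dx d′x with d′ ≟ d
  ... | yes d′≡d = d′≡d
  ... | no d′≢d  = ⊥-elim (no-isolating-subdivision dx D≤k
    (isolating-subdivision-preserved D iso repair (inj₁ (new-vertex-dominated D d∈D))))
    where
    open Subdivision G d x
    repair : ∀ {c y} → c ∈ D → IsUV c y → Nᵤᵥ D (suc y)
    repair _   (inj₁ (_ , refl)) = dominated-by D d′∈D d′x λ where
      (inj₁ (d′≡d , _)) → d′≢d d′≡d
      (inj₂ (refl , _)) → x∉D d′∈D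
    repair c∈D (inj₂ (refl , _)) = ⊥-elim (x∉D c∈D)

  private-neighbour : ∀ {x d} → x ∉ D → d ∈ D → Adj G d x → ∃[ y ] (Adj G x y × ¬ ND y)
  private-neighbour {x} {d} x∉D d∈D dx = counterexample (adj? G x) (inClosedNbhd? G D) λ all →
    no-isolating-subdivision dx D≤k
      (isolating-subdivision D (inj₁ (new-vertex-dominated D d∈D)) λ a b ab →
        Sum.[ covered ab all , swap ∘ covered (adj-sym a b ab) all ]′ (iso a b ab))
    where
    open Subdivision G d x
    covered : ∀ {a b} → Adj G a b → (∀ y → Adj G x y → ND y) → ND a →
              Nᵤᵥ D (suc a) ⊎ Nᵤᵥ D (suc b)
    covered ab all Na with nbhd-lift D Na
    ... | inj₁ N′a                         = inj₁ N′a
    ... | inj₂ (_ , c∈D , inj₂ (refl , _)) = ⊥-elim (x∉D c∈D)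
    ... | inj₂ (_ , _   , inj₁ (_ , refl)) with nbhd-lift D (all _ ab)
    ...   | inj₁ N′b                         = inj₂ N′b
    ...   | inj₂ (_ , c∈D , inj₂ (refl , _)) = ⊥-elim (x∉D c∈D)
    ...   | inj₂ (_ , _   , inj₁ (_ , refl)) = ⊥-elim (adj-irrefl _ ab)

  boundary-of-neighbour : ∀ {d x} → d ∈ D → Adj G d x → Boundary G D x
  boundary-of-neighbour d∈D dx = (λ x∈D → independent d∈D x∈D dx) , inj₂ (_ , d∈D , dx)

  ¬leaf-beside-private-neighbour : ∀ {d x y} → d ∈ D → Adj G d x → (∀ z → Adj G d z → z ≡ x) →
                                   Adj G x y → ¬ ND y → ⊥
  ¬leaf-beside-private-neighbour {d} {x} {y} d∈D dx only-x xy ¬Ny = no-isolating-subdivision xy S≤k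
    (isolating-subdivision S (inj₁ (new-vertex-dominated S x∈S)) λ a b ab →
      Sum.[ covered ab , swap ∘ covered (adj-sym a b ab) ]′ (iso a b ab))
    where
    open Subdivision G x y
    x∉D : x ∉ D
    x∉D = proj₁ (boundary-of-neighbour d∈D dx)

    S : Subset n
    S = (D - d) ∪ ⁅ x ⁆

    x∈S : x ∈ S
    x∈S = x∈p∪q⁺ (inj₂ (x∈⁅x⁆ x))

    kept : ∀ {c} → c ∈ D → c ≢ d → c ∈ S
    kept c∈D c≢d = x∈p∪q⁺ (inj₁ (x∈p∧x≢y⇒x∈p-y c∈D c≢d))

    S≤k : ∣ S ∣ ≤ k
    S≤k = begin
      ∣ (D - d) ∪ ⁅ x ⁆ ∣     ≤⟨ ∣p∪q∣≤∣p∣+∣q∣ (D - d) ⁅ x ⁆ ⟩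
      ∣ D - d ∣ + ∣ ⁅ x ⁆ ∣   ≡⟨ cong (∣ D - d ∣ +_) (∣⁅x⁆∣≡1 x) ⟩
      ∣ D - d ∣ + 1           ≡⟨ +-comm ∣ D - d ∣ 1 ⟩
      suc ∣ D - d ∣           ≤⟨ x∈p⇒∣p-x∣<∣p∣ d∈D ⟩
      ∣ D ∣                   ≡⟨ size ⟩
      k                       ∎
      where open ≤-Reasoning

    covered : ∀ {a b} → Adj G a b → ND a → Nᵤᵥ S (suc a) ⊎ Nᵤᵥ S (suc b)
    covered {a} ab (inj₁ a∈D) with a ≟ d
    ... | yes refl = inj₂ (inj₁ (there (subst (_∈ S) (sym (only-x _ ab)) x∈S)))
    ... | no a≢d   = inj₁ (inj₁ (there (kept a∈D a≢d)))
    covered ab (inj₂ (c , c∈D , ca)) with c ≟ d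
    ... | yes refl = inj₁ (inj₁ (there (subst (_∈ S) (sym (only-x _ ca)) x∈S)))
    ... | no c≢d   = inj₁ (dominated-by S (kept c∈D c≢d) ca λ where
      (inj₁ (refl , _)) → x∉D c∈D
      (inj₂ (refl , _)) → ¬Ny (inj₁ c∈D))

  second-neighbour : ∀ {d x} → d ∈ D → Adj G d x → ∃[ y ] (Adj G d y × y ≢ x)
  second-neighbour d∈D dx = counterexample (adj? G _) (_≟ _) λ only-x →
    let y , xy , ¬Ny = private-neighbour (proj₁ (boundary-of-neighbour d∈D dx)) d∈D dx
    in ¬leaf-beside-private-neighbour d∈D dx only-x xy ¬Ny

  neighbour-of-non-boundary : ∀ {a b} → Adj G a b → ¬ Boundary G D a → Boundary G D b
  neighbour-of-non-boundary {a} {b} ab ¬∂a with a ∈? D | b ∈? D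
  ... | yes a∈D | _       = boundary-of-neighbour a∈D ab
  ... | no a∉D  | yes b∈D = ⊥-elim (¬∂a (a∉D , inj₂ (b , b∈D , adj-sym a b ab)))
  ... | no a∉D  | no b∉D  = b∉D , Sum.[ (λ Na → ⊥-elim (¬∂a (a∉D , Na))) , id ]′ (iso a b ab)

  boundary-proper : ProperColouring G (λ v → does (boundary? G D v))
  boundary-proper {a} {b} ab =
    does-complement {Boundary G D a} {Boundary G D b} (boundary? G D a) (boundary? G D b)
      (λ ∂a ∂b → boundary-independent ∂a ∂b ab) (neighbour-of-non-boundary ab)

  boundary-two-neighbours : ∀ {x} → Boundary G D x → ∃[ y ] ∃[ z ] (Adj G x y × Adj G x z × y ≢ z)
  boundary-two-neighbours (x∉D , inj₁ x∈D) = ⊥-elim (x∉D x∈D)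
  boundary-two-neighbours (x∉D , inj₂ (d , d∈D , dx)) =
    let y , xy , ¬Ny = private-neighbour x∉D d∈D dx
    in d , y , adj-sym d _ dx , xy , λ d≡y → ¬Ny (subst ND d≡y (inj₁ d∈D))

  neighbour-in-difference : ∀ {S x d} → Boundary G S x → d ∈ D → d ∉ S → Adj G d x →
                            ∃[ b ] ((b ∈ S × b ∉ D) × Adj G b x × b ≢ d)
  neighbour-in-difference (x∉S , inj₁ x∈S) _ _ _ = ⊥-elim (x∉S x∈S)
  neighbour-in-difference {d = d} (x∉S , inj₂ (b , b∈S , bx)) d∈D d∉S dx =
    b , (b∈S , b∉D) , bx , λ { refl → d∉S b∈S }
    where
    b∉D : b ∉ D
    b∉D b∈D = d∉S (subst (_∈ _) b≡d b∈S)
      where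
      b≡d : b ≡ d
      b≡d = unique-neighbour (proj₁ (boundary-of-neighbour d∈D dx)) d∈D b∈D dx bx

module Uniqueness {n : ℕ} {T : Graph n} (adj-sym : Symmetric T) (adj-irrefl : Irreflexive T)
                  (connected : Connected T) (acyclic : ¬ HasCycle T)
                  (critical : IotaOneCritical T) {k : ℕ} (ι : IsolationNumber T k)
                  {D D′ : Subset n} (iso : Isolating T D) (size : ∣ D ∣ ≡ k)
                  (iso′ : Isolating T D′) (size′ : ∣ D′ ∣ ≡ k) where

  private
    module M  = MinimumIsolating adj-sym adj-irrefl critical ι iso size
    module M′ = MinimumIsolating adj-sym adj-irrefl critical ι iso′ size′

    root : Fin n
    root = proj₁ (proj₁ critical)

    neighbour : ∀ v → ∃[ w ] Adj T v w
    neighbour = connected⇒neighbour T connected (proj₁ critical)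

    no-core : ∀ {W} → MinDegree≥2 T W → ∀ {v} → ¬ W v
    no-core = acyclic⇒¬minDegree≥2 adj-sym adj-irrefl acyclic

  boundaries-not-complementary : ¬ (∀ v → Boundary T D v ⊎ Boundary T D′ v)
  boundaries-not-complementary cover = no-core branching (cover root)
    where
    branching : MinDegree≥2 T (λ v → Boundary T D v ⊎ Boundary T D′ v)
    branching ∂c =
      let y , z , cy , cz , y≢z =
            Sum.[ M.boundary-two-neighbours , M′.boundary-two-neighbours ]′ ∂c
      in two-neighbours T cy cz y≢z (cover y) (cover z)

  module _ (same : ∀ {v} → Boundary T D v → Boundary T D′ v)
           (same′ : ∀ {v} → Boundary T D′ v → Boundary T D v) where

    Difference : Fin n → Set
    Difference v = (v ∈ D × v ∉ D′) ⊎ (v ∈ D′ × v ∉ D)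

    Core : Fin n → Set
    Core v = Difference v ⊎ (Boundary T D v × Boundary T D′ v × ∃[ d ] (Difference d × Adj T d v))

    private
      branching-from : ∀ {c} → (∀ {x} → Adj T c x → ∃[ y ] (Adj T c y × y ≢ x)) →
                       (∀ {q} → Adj T c q → Core q) → TwoNeighboursIn T Core c
      branching-from {c} second in-core =
        let x , cx = neighbour c
            y , cy , y≢x = second cx
        in two-neighbours T {W = Core} cy cx y≢x (in-core cy) (in-core cx)

    core-branching : MinDegree≥2 T Core
    core-branching (inj₁ (inj₁ (c∈D , c∉D′))) = branching-from (M.second-neighbour c∈D) λ cq →
      let ∂q = M.boundary-of-neighbour c∈D cq
      in inj₂ (∂q , same ∂q , _ , inj₁ (c∈D , c∉D′) , cq)
    core-branching (inj₁ (inj₂ (c∈D′ , c∉D))) = branching-from (M′.second-neighbour c∈D′) λ cq →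
      let ∂q = M′.boundary-of-neighbour c∈D′ cq
      in inj₂ (same′ ∂q , ∂q , _ , inj₂ (c∈D′ , c∉D) , cq)
    core-branching (inj₂ (_ , ∂′x , d , inj₁ (d∈D , d∉D′) , dx)) =
      let b , (b∈D′ , b∉D) , bx , b≢d = M.neighbour-in-difference ∂′x d∈D d∉D′ dx
      in two-neighbours T {W = Core} (adj-sym b _ bx) (adj-sym d _ dx) b≢d
           (inj₁ (inj₂ (b∈D′ , b∉D))) (inj₁ (inj₁ (d∈D , d∉D′)))
    core-branching (inj₂ (∂x , _ , d , inj₂ (d∈D′ , d∉D) , dx)) =
      let b , (b∈D , b∉D′) , bx , b≢d = M′.neighbour-in-difference ∂x d∈D′ d∉D dx
      in two-neighbours T {W = Core} (adj-sym b _ bx) (adj-sym d _ dx) b≢d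
           (inj₁ (inj₁ (b∈D , b∉D′))) (inj₁ (inj₂ (d∈D′ , d∉D)))

    same-boundary⇒equal : D′ ≡ D
    same-boundary⇒equal = ⊆-antisym D′⊆D D⊆D′
      where
      D′⊆D : D′ ⊆ D
      D′⊆D {v} v∈D′ with v ∈? D
      ... | yes v∈D = v∈D
      ... | no v∉D  = ⊥-elim (no-core core-branching (inj₁ (inj₂ (v∈D′ , v∉D))))
      D⊆D′ : D ⊆ D′
      D⊆D′ {v} v∈D with v ∈? D′
      ... | yes v∈D′ = v∈D′
      ... | no v∉D′  = ⊥-elim (no-core core-branching (inj₁ (inj₁ (v∈D , v∉D′))))

  minimum-isolating-unique : D′ ≡ D
  minimum-isolating-unique = Sum.[ equal⇒ , opposite⇒ ]′
    (proper-colourings-equal-or-opposite T connected M.boundary-proper M′.boundary-proper root)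
    where
    equal⇒ : (∀ v → does (boundary? T D′ v) ≡ does (boundary? T D v)) → D′ ≡ D
    equal⇒ equal = same-boundary⇒equal
      (λ {v} → does-transport (boundary? T D v) (boundary? T D′ v) (equal v))
      (λ {v} → does-transport (boundary? T D′ v) (boundary? T D v) (sym (equal v)))
    opposite⇒ : (∀ v → does (boundary? T D′ v) ≡ not (does (boundary? T D v))) → D′ ≡ D
    opposite⇒ opposite = ⊥-elim (boundaries-not-complementary λ v →
      does-complement⁻ (boundary? T D v) (boundary? T D′ v) (opposite v))

corollary4p10 : ∀ (n : ℕ) (T : Graph n) → IsTree T → IotaOneCritical T →
    ∀ k → IsolationNumber T k →
    ∃[ D ] (Isolating T D × ∣ D ∣ ≡ k ×
      (∀ D' → Isolating T D' → ∣ D' ∣ ≡ k → D' ≡ D))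
corollary4p10 n T (adj-sym , adj-irrefl , connected , acyclic) critical k ι =
  let D , iso , size = proj₁ ι
  in D , iso , size , λ D′ iso′ size′ →
       Uniqueness.minimum-isolating-unique
         adj-sym adj-irrefl connected acyclic critical ι iso size iso′ size′
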